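{- Let $Q=[0,1]\cap\mathbb{Q}$. There exists a bijective rational Costas cloud on $Q\times Q$: a bijection $f:Q\to Q$ which is discontinuous at every point of $Q$, whose graph $\{(x,f(x)):x\in Q\}$ is dense in $[0,1]\times[0,1]$, and which has the Costas property, i.e. for all $a_1,a_2\in Q$ and all $t\neq0$ with $t+a_1,t+a_2\in Q$, $f(t+a_1)+f(a_2)=f(t+a_2)+f(a_1)$ implies $a_1=a_2$.
   Context: For a set $A\subseteq\mathbb{Q}$, a rational Costas cloud is a nowhere continuous injection $f:A\to A$ with the Costas property (with respect to all nonzero displacements $t$ such that $(t+A)\cap A\neq\emptyset$), whose graph is dense in $I(A)\times I(A)$, where $I(A)$ is the smallest closed interval containing $A$. -}

module Defs where

open import Data.Rational using (ℚ; 0ℚ; 1ℚ; _+_; _-_; ∣_∣; _≤_; _<_)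
open import Data.Product using (Σ; _×_; ∃)
open import Relation.Binary.PropositionalEquality using (_≡_; _≢_)
open import Relation.Nullary using (¬_)

InQ : ℚ → Set
InQ x = (0ℚ ≤ x) × (x ≤ 1ℚ)

-- f (a function ℚ → ℚ, only its restriction to Q matters) maps Q into Q
MapsQ : (ℚ → ℚ) → Set
MapsQ f = ∀ x → InQ x → InQ (f x)

InjectiveOnQ : (ℚ → ℚ) → Set
InjectiveOnQ f = ∀ x y → InQ x → InQ y → f x ≡ f y → x ≡ y

SurjectiveOntoQ : (ℚ → ℚ) → Set
SurjectiveOntoQ f = ∀ y → InQ y → Σ ℚ (λ x → InQ x × (f x ≡ y))

-- Continuity at x of f restricted to Q (subspace topology of Q ⊆ ℝ;
-- rational ε, δ suffice since ℚ is dense in ℝ)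
ContinuousAtQ : (ℚ → ℚ) → ℚ → Set
ContinuousAtQ f x =
  ∀ ε → 0ℚ < ε →
    Σ ℚ (λ δ → (0ℚ < δ) ×
      (∀ y → InQ y → ∣ y - x ∣ < δ → ∣ f y - f x ∣ < ε))

NowhereContinuousQ : (ℚ → ℚ) → Set
NowhereContinuousQ f = ∀ x → InQ x → ¬ ContinuousAtQ f x

-- graph {(x, f x) : x ∈ Q} is dense in [0,1]×[0,1]; since rational points
-- are dense in [0,1]², it suffices (and is equivalent) to approximate every
-- rational point (u,v) of [0,1]² within every rational ε > 0 (sup-norm balls)
GraphDenseQ : (ℚ → ℚ) → Set
GraphDenseQ f =
  ∀ u v ε → InQ u → InQ v → 0ℚ < ε →
    Σ ℚ (λ x → InQ x × (∣ x - u ∣ < ε) × (∣ f x - v ∣ < ε))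

CostasQ : (ℚ → ℚ) → Set
CostasQ f =
  ∀ t a₁ a₂ → t ≢ 0ℚ → InQ a₁ → InQ a₂ → InQ (t + a₁) → InQ (t + a₂) →
    f (t + a₁) + f a₂ ≡ f (t + a₂) + f a₁ → a₁ ≡ a₂

BijectiveRationalCostasCloud : (ℚ → ℚ) → Set
BijectiveRationalCostasCloud f =
  MapsQ f × InjectiveOnQ f × SurjectiveOntoQ f ×
  NowhereContinuousQ f × GraphDenseQ f × CostasQ f

-- The cloud is the limit of a back-and-forth construction. A finite set of
-- points of Q × Q is kept which is the graph of a partial injection and a
-- Sidon set (p + q = r + s forces {p, q} = {r, s}); for functions the Sidon
-- property of a graph implies the Costas property. Such a set can always be
-- extended by a point with a prescribed abscissa, a prescribed ordinate, or
-- inside a prescribed box, because only finitely many values of a single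
-- coordinate create a new additive relation. Scheduling each rational of Q
-- (as abscissa and as ordinate) and each rational box at some stage, the union
-- of the stages is the graph of a bijection of Q which meets every box, hence
-- is dense, and a function with a dense graph is continuous nowhere.
module Submission where

open import Defs
open import Algebra.Bundles using (CommutativeMonoid)
open import Data.Empty using (⊥; ⊥-elim)
open import Data.Integer using (+_; -[1+_])
open import Data.List using (List; []; _∷_; map; _++_; cartesianProductWith)
open import Data.List.Membership.Propositional using (_∈_; _∉_)
open import Data.List.Membership.Propositional.Properties
  using (∈-map⁺; ∈-map⁻; ∈-++⁺ˡ; ∈-++⁺ʳ; ∈-cartesianProductWith⁺)
open import Data.List.Relation.Binary.Subset.Propositional using (_⊆_)
open import Data.List.Relation.Unary.Any using (here; there)
open import Data.Maybe using (Maybe; just; nothing)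
open import Data.Nat as ℕ using (ℕ; zero; suc; _≤′_; ≤′-refl; ≤′-step)
import Data.Nat.Properties as ℕ
open import Data.Product using (Σ; _×_; _,_; proj₁; proj₂)
open import Data.Rational
open import Data.Rational.Properties
open import Data.Rational.Solver using (module +-*-Solver)
open import Data.Sum using (_⊎_; inj₁; inj₂)
open import Function using (_∘_)
open import Relation.Binary.PropositionalEquality
open import Relation.Nullary using (Dec; yes; no)
open import Relation.Nullary.Decidable using (_×-dec_)

open import Algebra.Properties.Group +-0-group
  using () renaming (∙-cancelˡ to +-cancelˡ; x≈z//y to +-moveʳ; identityˡ-unique to +-identityˡ-unique)
open import Algebra.Properties.CommutativeSemigroup (CommutativeMonoid.commutativeSemigroup +-0-commutativeMonoid)
  using (xy∙z≈xz∙y)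
open import Data.List.Membership.DecPropositional _≟_ using (_∈?_)

open +-*-Solver

-- Cantor pairing: unpair runs through ℕ × ℕ diagonal by diagonal,
-- (0 , s), (1 , s - 1), …, (s , 0), (0 , s + 1), …

cantorSuc : ℕ × ℕ → ℕ × ℕ
cantorSuc (a , zero)  = 0 , suc a
cantorSuc (a , suc b) = suc a , b

unpair : ℕ → ℕ × ℕ
unpair zero    = 0 , 0
unpair (suc n) = cantorSuc (unpair n)

triangle : ℕ → ℕ
triangle zero    = 0
triangle (suc s) = suc (s ℕ.+ triangle s)

pair : ℕ → ℕ → ℕ
pair a b = a ℕ.+ triangle (a ℕ.+ b)

unpair-along-diagonal : ∀ a b k → unpair k ≡ (0 , a ℕ.+ b) → unpair (a ℕ.+ k) ≡ (a , b)
unpair-along-diagonal zero    b k h = h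
unpair-along-diagonal (suc a) b k h =
  cong cantorSuc (unpair-along-diagonal a (suc b) k (trans h (cong (0 ,_) (sym (ℕ.+-suc a b)))))

unpair-triangle : ∀ s → unpair (triangle s) ≡ (0 , s)
unpair-triangle zero    = refl
unpair-triangle (suc s) = cong cantorSuc (unpair-along-diagonal s 0 (triangle s)
  (trans (unpair-triangle s) (cong (0 ,_) (sym (ℕ.+-identityʳ s)))))

unpair-pair : ∀ a b → unpair (pair a b) ≡ (a , b)
unpair-pair a b = unpair-along-diagonal a b _ (unpair-triangle (a ℕ.+ b))

decode : ℕ → ℚ
decode n = + proj₁ (unpair n) / suc (proj₂ (unpair n))

encode : ℚ → ℕ
encode (mkℚ (+ a)    b _) = pair a b
encode (mkℚ -[1+ _ ] _ _) = 0

decode-encode : ∀ {x} → 0ℚ ≤ x → decode (encode x) ≡ x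
decode-encode {x@(mkℚ (+ a) b _)} _ rewrite unpair-pair a b = ↥p/↧p≡p x
decode-encode {mkℚ -[1+ _ ] _ _} (*≤* ())

-- Sidon sets of points and Costas graphs

Point : Set
Point = ℚ × ℚ

_⊕_ : Point → Point → Point
p ⊕ q = proj₁ p + proj₁ q , proj₂ p + proj₂ q

⊕-comm : ∀ p q → p ⊕ q ≡ q ⊕ p
⊕-comm p q = cong₂ _,_ (+-comm (proj₁ p) (proj₁ q)) (+-comm (proj₂ p) (proj₂ q))

⊕-cancelˡ : ∀ p q r → p ⊕ q ≡ p ⊕ r → q ≡ r
⊕-cancelˡ p q r h = cong₂ _,_ (+-cancelˡ (proj₁ p) (proj₁ q) (proj₁ r) (cong proj₁ h))
                              (+-cancelˡ (proj₂ p) (proj₂ q) (proj₂ r) (cong proj₂ h))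

⊕-cancelʳ : ∀ p q r → p ⊕ r ≡ q ⊕ r → p ≡ q
⊕-cancelʳ p q r h = ⊕-cancelˡ r p q (trans (⊕-comm r p) (trans h (⊕-comm q r)))

Sidon : (Point → Set) → Set
Sidon G = ∀ {p q r s} → G p → G q → G r → G s →
  p ⊕ q ≡ r ⊕ s → (p ≡ r × q ≡ s) ⊎ (p ≡ s × q ≡ r)

record CostasGraph (G : Point → Set) : Set where
  field
    inQ        : ∀ {p} → G p → InQ (proj₁ p) × InQ (proj₂ p)
    functional : ∀ {x y y′} → G (x , y) → G (x , y′) → y ≡ y′
    injective  : ∀ {x x′ y} → G (x , y) → G (x′ , y) → x ≡ x′
    sidon      : Sidon G

Graph : Set
Graph = List Point

[]-costas : CostasGraph (_∈ [])
[]-costas = record { inQ = λ () ; functional = λ () ; injective = λ () ; sidon = λ () }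

Fresh : Graph → Point → Set
Fresh L P = (∀ {a b c} → a ∈ L → b ∈ L → c ∈ L → P ⊕ a ≢ b ⊕ c)
          × (∀ {b c} → b ∈ L → c ∈ L → P ⊕ P ≢ b ⊕ c)

∷-sidon : ∀ {L P} → Sidon (_∈ L) → Fresh L P → Sidon (_∈ P ∷ L)
∷-sidon {L} {P} S (fresh₁ , fresh₂) = sidon
  where
  sidon : Sidon (_∈ P ∷ L)
  sidon (there a) (there b) (there c) (there d) h = S a b c d h
  sidon (here refl) (there b) (there c) (there d) h = ⊥-elim (fresh₁ b c d h)
  sidon {p} (there a) (here refl) (there c) (there d) h = ⊥-elim (fresh₁ a c d (trans (⊕-comm P p) h))
  sidon (there a) (there b) (here refl) (there d) h = ⊥-elim (fresh₁ d a b (sym h))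
  sidon {r = r} (there a) (there b) (there c) (here refl) h =
    ⊥-elim (fresh₁ c a b (trans (⊕-comm P r) (sym h)))
  sidon (here refl) (here refl) (there c) (there d) h = ⊥-elim (fresh₂ c d h)
  sidon (there a) (there b) (here refl) (here refl) h = ⊥-elim (fresh₂ a b (sym h))
  sidon {q = q} {s = s} (here refl) _ (here refl) _ h = inj₁ (refl , ⊕-cancelˡ P q s h)
  sidon {q = q} {r = r} (here refl) _ _ (here refl) h = inj₂ (refl , ⊕-cancelˡ P q r (trans h (⊕-comm r P)))
  sidon {p} {s = s} _ (here refl) (here refl) _ h = inj₂ (⊕-cancelˡ P p s (trans (⊕-comm P p) h) , refl)
  sidon {p} {r = r} _ (here refl) _ (here refl) h = inj₁ (⊕-cancelʳ p r P h , refl)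

∷-costas : ∀ {L x y} → CostasGraph (_∈ L) → InQ x → InQ y →
  x ∉ map proj₁ L → y ∉ map proj₂ L → Fresh L (x , y) → CostasGraph (_∈ (x , y) ∷ L)
∷-costas G qx qy x-new y-new fresh = record
  { inQ        = λ { (here refl) → qx , qy ; (there m) → inQ m }
  ; functional = λ { (here refl) (here refl) → refl
                   ; (here refl) (there m) → ⊥-elim (x-new (∈-map⁺ proj₁ m))
                   ; (there m) (here refl) → ⊥-elim (x-new (∈-map⁺ proj₁ m))
                   ; (there m) (there m′) → functional m m′ }
  ; injective  = λ { (here refl) (here refl) → refl
                   ; (here refl) (there m) → ⊥-elim (y-new (∈-map⁺ proj₂ m))
                   ; (there m) (here refl) → ⊥-elim (y-new (∈-map⁺ proj₂ m))
                   ; (there m) (there m′) → injective m m′ }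
  ; sidon      = ∷-sidon sidon fresh
  }
  where open CostasGraph G

module _ (S : ℕ → Graph) (S-mono : ∀ {m n} → m ℕ.≤ n → S m ⊆ S n)
         (S-costas : ∀ n → CostasGraph (_∈ S n)) where

  ⋃-costas : CostasGraph (λ p → Σ ℕ λ n → p ∈ S n)
  ⋃-costas = record
    { inQ        = λ (n , p∈) → inQ (S-costas n) p∈
    ; functional = λ (m , a) (n , b) → functional (S-costas (m ℕ.⊔ n)) (raiseˡ m n a) (raiseʳ m n b)
    ; injective  = λ (m , a) (n , b) → injective (S-costas (m ℕ.⊔ n)) (raiseˡ m n a) (raiseʳ m n b)
    ; sidon      = λ (k₁ , a) (k₂ , b) (k₃ , c) (k₄ , d) →
        let k₁₂ = k₁ ℕ.⊔ k₂ ; k₃₄ = k₃ ℕ.⊔ k₄ in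
        sidon (S-costas (k₁₂ ℕ.⊔ k₃₄))
          (raiseˡ k₁₂ k₃₄ (raiseˡ k₁ k₂ a)) (raiseˡ k₁₂ k₃₄ (raiseʳ k₁ k₂ b))
          (raiseʳ k₁₂ k₃₄ (raiseˡ k₃ k₄ c)) (raiseʳ k₁₂ k₃₄ (raiseʳ k₃ k₄ d))
    }
    where
    open CostasGraph

    raiseˡ : ∀ m n → S m ⊆ S (m ℕ.⊔ n)
    raiseˡ m n = S-mono (ℕ.m≤m⊔n m n)

    raiseʳ : ∀ m n → S n ⊆ S (m ℕ.⊔ n)
    raiseʳ m n = S-mono (ℕ.m≤n⊔m m n)

-- Values of one coordinate at which a new point would repeat a value or create a new additive relation

pairSums : (Point → ℚ) → Graph → List ℚ
pairSums π L = cartesianProductWith (λ b c → π b + π c) L L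

Obstructions : (Point → ℚ) → Graph → List ℚ
Obstructions π L =
  map π L ++ cartesianProductWith (λ s a → s - π a) (pairSums π L) L ++ map (_* ½) (pairSums π L)

Additive : (Point → ℚ) → Set
Additive π = ∀ p q → π (p ⊕ q) ≡ π p + π q

double-half : ∀ c → (c + c) * ½ ≡ c
double-half = solve 1 (λ c → (c :+ c) :* con ½ := c) refl

∉obstructions⇒∉map : ∀ {π L c} → c ∉ Obstructions π L → c ∉ map π L
∉obstructions⇒∉map c∉ = c∉ ∘ ∈-++⁺ˡ

∉obstructions⇒fresh : ∀ {L} π P → Additive π → π P ∉ Obstructions π L → Fresh L P
∉obstructions⇒fresh {L} π P additive P∉ = triple , double
  where
  π-sum : ∀ {p q r s} → p ⊕ q ≡ r ⊕ s → π p + π q ≡ π r + π s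
  π-sum {p} {q} {r} {s} h = trans (sym (additive p q)) (trans (cong π h) (additive r s))

  triple : ∀ {a b c} → a ∈ L → b ∈ L → c ∈ L → P ⊕ a ≢ b ⊕ c
  triple {a} a∈ b∈ c∈ h = P∉ (∈-++⁺ʳ (map π L) (∈-++⁺ˡ
    (subst (_∈ _) (sym (+-moveʳ (π P) (π a) _ (π-sum h)))
      (∈-cartesianProductWith⁺ (λ s a → s - π a) (∈-cartesianProductWith⁺ (λ b c → π b + π c) b∈ c∈) a∈))))

  double : ∀ {b c} → b ∈ L → c ∈ L → P ⊕ P ≢ b ⊕ c
  double b∈ c∈ h = P∉ (∈-++⁺ʳ (map π L) (∈-++⁺ʳ _
    (subst (_∈ _) (trans (cong (_* ½) (sym (π-sum h))) (double-half (π P)))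
      (∈-map⁺ (_* ½) (∈-cartesianProductWith⁺ (λ b c → π b + π c) b∈ c∈)))))

∷-costas-freshˣ : ∀ {L x y} → CostasGraph (_∈ L) → InQ x → InQ y →
  x ∉ Obstructions proj₁ L → y ∉ map proj₂ L → CostasGraph (_∈ (x , y) ∷ L)
∷-costas-freshˣ {x = x} {y} G qx qy x-ok y-new =
  ∷-costas G qx qy (∉obstructions⇒∉map x-ok) y-new (∉obstructions⇒fresh proj₁ (x , y) (λ _ _ → refl) x-ok)

∷-costas-freshʸ : ∀ {L x y} → CostasGraph (_∈ L) → InQ x → InQ y →
  x ∉ map proj₁ L → y ∉ Obstructions proj₂ L → CostasGraph (_∈ (x , y) ∷ L)
∷-costas-freshʸ {x = x} {y} G qx qy x-new y-ok =
  ∷-costas G qx qy x-new (∉obstructions⇒∉map y-ok) (∉obstructions⇒fresh proj₂ (x , y) (λ _ _ → refl) y-ok)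

nearestAbove : ∀ {lo hi} → lo < hi → (bs : List ℚ) →
  Σ ℚ λ m → lo < m × m ≤ hi × (∀ {b} → b ∈ bs → b ≤ lo ⊎ m ≤ b)
nearestAbove {hi = hi} lo<hi [] = hi , lo<hi , ≤-refl , λ ()
nearestAbove {lo} lo<hi (b ∷ bs) with nearestAbove lo<hi bs | lo <? b
... | m , lo<m , m≤hi , sep | no lo≮b = m , lo<m , m≤hi , λ { (here refl) → inj₁ (≮⇒≥ lo≮b) ; (there k) → sep k }
... | m , lo<m , m≤hi , sep | yes lo<b with b <? m
...   | no b≮m = m , lo<m , m≤hi , λ { (here refl) → inj₂ (≮⇒≥ b≮m) ; (there k) → sep k }
...   | yes b<m = b , lo<b , ≤-trans (<⇒≤ b<m) m≤hi , λ { (here refl) → inj₂ ≤-refl ; (there k) → lower (sep k) }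
  where
  lower : ∀ {b′} → b′ ≤ lo ⊎ m ≤ b′ → b′ ≤ lo ⊎ b ≤ b′
  lower (inj₁ b′≤lo) = inj₁ b′≤lo
  lower (inj₂ m≤b′)  = inj₂ (≤-trans (<⇒≤ b<m) m≤b′)

∃-between-∉ : ∀ {lo hi} → lo < hi → (bs : List ℚ) → Σ ℚ λ c → lo < c × c < hi × c ∉ bs
∃-between-∉ {lo} lo<hi bs with nearestAbove lo<hi bs
... | m , lo<m , m≤hi , sep with <-dense lo<m
...   | c , lo<c , c<m = c , lo<c , <-≤-trans c<m m≤hi , λ c∈ → excluded (sep c∈)
  where
  excluded : c ≤ lo ⊎ m ≤ c → ⊥
  excluded (inj₁ c≤lo) = <-irrefl refl (<-≤-trans lo<c c≤lo)
  excluded (inj₂ m≤c)  = <-irrefl refl (<-≤-trans c<m m≤c)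

UnitSubinterval : ℚ → ℚ → Set
UnitSubinterval lo hi = 0ℚ ≤ lo × lo < hi × hi ≤ 1ℚ

unitSubinterval⇒InQ : ∀ {lo hi c} → UnitSubinterval lo hi → lo < c → c < hi → InQ c
unitSubinterval⇒InQ (0≤lo , _ , hi≤1) lo<c c<hi = ≤-trans 0≤lo (<⇒≤ lo<c) , ≤-trans (<⇒≤ c<hi) hi≤1

0<1 : 0ℚ < 1ℚ
0<1 = positive⁻¹ 1ℚ

InBox : ℚ → ℚ → ℚ → ℚ → Point → Set
InBox lo₁ hi₁ lo₂ hi₂ (x , y) = (lo₁ < x × x < hi₁) × (lo₂ < y × y < hi₂)

MeetsEveryBox : (Point → Set) → Set
MeetsEveryBox G = ∀ {lo₁ hi₁ lo₂ hi₂} → UnitSubinterval lo₁ hi₁ → UnitSubinterval lo₂ hi₂ →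
  Σ Point λ P → G P × InBox lo₁ hi₁ lo₂ hi₂ P

∣p-q∣≡∣q-p∣ : ∀ p q → ∣ p - q ∣ ≡ ∣ q - p ∣
∣p-q∣≡∣q-p∣ p q =
  trans (cong ∣_∣ (solve 2 (λ p q → p :- q := :- (q :- p)) refl p q)) (∣-p∣≡∣p∣ (q - p))

∣p-r∣≤∣p-q∣+∣q-r∣ : ∀ p q r → ∣ p - r ∣ ≤ ∣ p - q ∣ + ∣ q - r ∣
∣p-r∣≤∣p-q∣+∣q-r∣ p q r =
  subst (λ s → ∣ s ∣ ≤ ∣ p - q ∣ + ∣ q - r ∣) (solve 3 (λ p q r → (p :- q) :+ (q :- r) := p :- r) refl p q r)
    (∣p+q∣≤∣p∣+∣q∣ (p - q) (q - r))

∣p-q∣<ε : ∀ {p q ε} → q - ε < p → p < q + ε → ∣ p - q ∣ < ε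
∣p-q∣<ε {p} {q} {ε} lower upper with ∣p∣≡p∨∣p∣≡-p (p - q)
... | inj₁ eq = subst₂ _<_ (sym eq) (solve 2 (λ q ε → (q :+ ε) :- q := ε) refl q ε) (+-monoˡ-< (- q) upper)
... | inj₂ eq = subst₂ _<_ (trans (solve 2 (λ p q → q :- p := :- (p :- q)) refl p q) (sym eq))
                           (solve 2 (λ q ε → q :- (q :- ε) := ε) refl q ε)
                           (+-monoʳ-< q (neg-antimono-< lower))

p<p+q : ∀ p {q} → 0ℚ < q → p < p + q
p<p+q p {q} q>0 = subst (_< p + q) (+-identityʳ p) (+-monoʳ-< p q>0)

p-q<p : ∀ p {q} → 0ℚ < q → p - q < p
p-q<p p {q} q>0 = subst (p - q <_) (+-identityʳ p) (+-monoʳ-< p (neg-antimono-< q>0))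

unitSubinterval-within : ∀ {u ε} → InQ u → 0ℚ < ε →
  Σ ℚ λ lo → Σ ℚ λ hi → UnitSubinterval lo hi × u - ε ≤ lo × hi ≤ u + ε
unitSubinterval-within {u} {ε} (0≤u , u≤1) ε>0 with u <? 1ℚ | ≤-total (u + ε) 1ℚ | ≤-total 0ℚ (u - ε)
... | yes u<1 | inj₁ u+ε≤1 | _ = u , u + ε , (0≤u , p<p+q u ε>0 , u+ε≤1) , <⇒≤ (p-q<p u ε>0) , ≤-refl
... | yes u<1 | inj₂ 1≤u+ε | _ = u , 1ℚ , (0≤u , u<1 , ≤-refl) , <⇒≤ (p-q<p u ε>0) , 1≤u+ε
... | no u≮1  | _ | inj₁ 0≤u-ε = u - ε , u , (0≤u-ε , p-q<p u ε>0 , u≤1) , ≤-refl , <⇒≤ (p<p+q u ε>0)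
... | no u≮1  | _ | inj₂ u-ε≤0 =
  0ℚ , u , (≤-refl , <-≤-trans 0<1 (≮⇒≥ u≮1) , u≤1) , u-ε≤0 , <⇒≤ (p<p+q u ε>0)

unitSubinterval-near : ∀ {u ε} → InQ u → 0ℚ < ε →
  Σ ℚ λ lo → Σ ℚ λ hi → UnitSubinterval lo hi × (∀ {c} → lo < c → c < hi → ∣ c - u ∣ < ε)
unitSubinterval-near qu ε>0 =
  let lo , hi , I , lower , upper = unitSubinterval-within qu ε>0
  in lo , hi , I , λ lo<c c<hi → ∣p-q∣<ε (≤-<-trans lower lo<c) (<-≤-trans c<hi upper)

¼ : ℚ
¼ = + 1 / 4

0<¼ : 0ℚ < ¼
0<¼ = positive⁻¹ ¼

0<p⊓q : ∀ {p q} → 0ℚ < p → 0ℚ < q → 0ℚ < p ⊓ q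
0<p⊓q {p} {q} p>0 q>0 with ⊓-sel p q
... | inj₁ p⊓q≡p = subst (0ℚ <_) (sym p⊓q≡p) p>0
... | inj₂ p⊓q≡q = subst (0ℚ <_) (sym p⊓q≡q) q>0

½-far : ∀ y → Σ ℚ λ v → InQ v × ½ ≤ ∣ v - y ∣
½-far y with y ≤? ½
... | yes y≤½ = 1ℚ , (<⇒≤ 0<1 , ≤-refl) , subst (½ ≤_) (sym (0≤p⇒∣p∣≡p (≤-trans (nonNegative⁻¹ ½) ½≤1-y))) ½≤1-y
  where
  ½≤1-y : ½ ≤ 1ℚ - y
  ½≤1-y = +-monoʳ-≤ 1ℚ (neg-antimono-≤ y≤½)
... | no y≰½ = 0ℚ , (≤-refl , <⇒≤ 0<1) , subst (½ ≤_) (sym ∣0-y∣≡y) (<⇒≤ ½<y)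
  where
  ½<y : ½ < y
  ½<y = ≰⇒> y≰½
  ∣0-y∣≡y : ∣ 0ℚ - y ∣ ≡ y
  ∣0-y∣≡y = trans (cong ∣_∣ (+-identityˡ (- y))) (trans (∣-p∣≡∣p∣ y) (0≤p⇒∣p∣≡p (≤-trans (nonNegative⁻¹ ½) (<⇒≤ ½<y))))

graphDenseQ⇒nowhereContinuousQ : ∀ {f} → GraphDenseQ f → NowhereContinuousQ f
graphDenseQ⇒nowhereContinuousQ {f} dense x qx continuous =
  let δ , δ>0 , close = continuous ¼ 0<¼
      v , qv , ½≤∣v-fx∣ = ½-far (f x)
      z , qz , ∣z-x∣<ρ , ∣fz-v∣<ρ = dense x v (δ ⊓ ¼) qx qv (0<p⊓q δ>0 0<¼)
      ∣fz-fx∣<¼ = close z qz (<-≤-trans ∣z-x∣<ρ (p⊓q≤p δ ¼))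
      ∣v-fz∣<¼ = subst (_< ¼) (∣p-q∣≡∣q-p∣ (f z) v) (<-≤-trans ∣fz-v∣<ρ (p⊓q≤q δ ¼))
  in <-irrefl refl (begin-strict
       ½                           ≤⟨ ½≤∣v-fx∣ ⟩
       ∣ v - f x ∣                 ≤⟨ ∣p-r∣≤∣p-q∣+∣q-r∣ v (f z) (f x) ⟩
       ∣ v - f z ∣ + ∣ f z - f x ∣ <⟨ +-mono-< ∣v-fz∣<¼ ∣fz-fx∣<¼ ⟩
       ¼ + ¼                       ≡⟨⟩
       ½                           ∎)
  where open ≤-Reasoning

module GraphInCostasGraph {G : Point → Set} (costas : CostasGraph G) {f : ℚ → ℚ} (graph : ∀ {x} → InQ x → G (x , f x)) where
  open CostasGraph costas

  costasGraph⇒MapsQ : MapsQ f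
  costasGraph⇒MapsQ x qx = proj₂ (inQ (graph qx))

  costasGraph⇒InjectiveOnQ : InjectiveOnQ f
  costasGraph⇒InjectiveOnQ x x′ qx qx′ fx≡fx′ =
    injective (graph qx) (subst (λ y → G (x′ , y)) (sym fx≡fx′) (graph qx′))

  costasGraph⇒SurjectiveOntoQ : (∀ {y} → InQ y → Σ ℚ λ x → G (x , y)) → SurjectiveOntoQ f
  costasGraph⇒SurjectiveOntoQ covers y qy =
    let x , g = covers qy
        qx = proj₁ (inQ g)
    in x , qx , functional (graph qx) g

  costasGraph⇒CostasQ : CostasQ f
  costasGraph⇒CostasQ t a₁ a₂ t≢0 qa₁ qa₂ qta₁ qta₂ h
    with sidon (graph qta₁) (graph qa₂) (graph qta₂) (graph qa₁)
           (cong₂ _,_ (xy∙z≈xz∙y t a₁ a₂) h)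
  ... | inj₁ (P₁≡P₃ , _) = +-cancelˡ t a₁ a₂ (cong proj₁ P₁≡P₃)
  ... | inj₂ (P₁≡P₄ , _) = ⊥-elim (t≢0 (+-identityˡ-unique t a₁ (cong proj₁ P₁≡P₄)))

  costasGraph⇒GraphDenseQ : MeetsEveryBox G → GraphDenseQ f
  costasGraph⇒GraphDenseQ meets u v ε qu qv ε>0 =
    let _ , _ , I₁ , near₁ = unitSubinterval-near qu ε>0
        _ , _ , I₂ , near₂ = unitSubinterval-near qv ε>0
        (x , y) , g , (lo₁<x , x<hi₁) , (lo₂<y , y<hi₂) = meets I₁ I₂
        qx = proj₁ (inQ g)
    in x , qx , near₁ lo₁<x x<hi₁ , subst (λ z → ∣ z - v ∣ < ε) (sym (functional (graph qx) g)) (near₂ lo₂<y y<hi₂)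

-- The construction

inQ? : ∀ x → Dec (InQ x)
inQ? x = (0ℚ ≤? x) ×-dec (x ≤? 1ℚ)

unitSubinterval? : ∀ lo hi → Dec (UnitSubinterval lo hi)
unitSubinterval? lo hi = (0ℚ ≤? lo) ×-dec (lo <? hi) ×-dec (hi ≤? 1ℚ)

unitInterval : UnitSubinterval 0ℚ 1ℚ
unitInterval = ≤-refl , 0<1 , ≤-refl

Stage : Set
Stage = Σ Graph λ L → CostasGraph (_∈ L)

Extension : Graph → Set
Extension L = Maybe (Σ Point λ P → CostasGraph (_∈ P ∷ L))

extend : (S : Stage) → Extension (proj₁ S) → Stage
extend S       nothing        = S
extend (L , _) (just (P , G)) = P ∷ L , G

extend-⊇ : ∀ S e → proj₁ S ⊆ proj₁ (extend S e)
extend-⊇ S nothing  = λ p∈ → p∈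
extend-⊇ S (just _) = there

coverDom : ℚ → (S : Stage) → Extension (proj₁ S)
coverDom x (L , G) with x ∈? map proj₁ L | inQ? x
... | no x-new | yes qx =
  let y , 0<y , y<1 , y-ok = ∃-between-∉ 0<1 (Obstructions proj₂ L)
  in just ((x , y) , ∷-costas-freshʸ G qx (unitSubinterval⇒InQ unitInterval 0<y y<1) x-new y-ok)
... | _ | _ = nothing

coverRan : ℚ → (S : Stage) → Extension (proj₁ S)
coverRan y (L , G) with y ∈? map proj₂ L | inQ? y
... | no y-new | yes qy =
  let x , 0<x , x<1 , x-ok = ∃-between-∉ 0<1 (Obstructions proj₁ L)
  in just ((x , y) , ∷-costas-freshˣ G (unitSubinterval⇒InQ unitInterval 0<x x<1) qy x-ok y-new)
... | _ | _ = nothing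

hitBox : ℚ → ℚ → ℚ → ℚ → (S : Stage) → Extension (proj₁ S)
hitBox lo₁ hi₁ lo₂ hi₂ (L , G) with unitSubinterval? lo₁ hi₁ | unitSubinterval? lo₂ hi₂
... | yes I₁@(_ , lo₁<hi₁ , _) | yes I₂@(_ , lo₂<hi₂ , _) =
  let x , lo₁<x , x<hi₁ , x-ok = ∃-between-∉ lo₁<hi₁ (Obstructions proj₁ L)
      y , lo₂<y , y<hi₂ , y-ok = ∃-between-∉ lo₂<hi₂ (Obstructions proj₂ L)
  in just ((x , y) , ∷-costas-freshˣ G (unitSubinterval⇒InQ I₁ lo₁<x x<hi₁)
                       (unitSubinterval⇒InQ I₂ lo₂<y y<hi₂) x-ok (∉obstructions⇒∉map y-ok))
... | _ | _ = nothing

coverDom-covers : ∀ {x} S → InQ x → x ∈ map proj₁ (proj₁ (extend S (coverDom x S)))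
coverDom-covers {x} (L , _) qx with x ∈? map proj₁ L | inQ? x
... | yes x∈ | _      = x∈
... | no _   | yes _  = here refl
... | no _   | no ¬qx = ⊥-elim (¬qx qx)

coverRan-covers : ∀ {y} S → InQ y → y ∈ map proj₂ (proj₁ (extend S (coverRan y S)))
coverRan-covers {y} (L , _) qy with y ∈? map proj₂ L | inQ? y
... | yes y∈ | _      = y∈
... | no _   | yes _  = here refl
... | no _   | no ¬qy = ⊥-elim (¬qy qy)
hitBox-hits : ∀ {lo₁ hi₁ lo₂ hi₂} S → UnitSubinterval lo₁ hi₁ → UnitSubinterval lo₂ hi₂ →
  Σ Point λ P → P ∈ proj₁ (extend S (hitBox lo₁ hi₁ lo₂ hi₂ S)) × InBox lo₁ hi₁ lo₂ hi₂ P
hitBox-hits {lo₁} {hi₁} {lo₂} {hi₂} (L , _) I₁ I₂ with unitSubinterval? lo₁ hi₁ | unitSubinterval? lo₂ hi₂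
... | yes (_ , lo₁<hi₁ , _) | yes (_ , lo₂<hi₂ , _) =
  let _ , lo₁<x , x<hi₁ , _ = ∃-between-∉ lo₁<hi₁ (Obstructions proj₁ L)
      _ , lo₂<y , y<hi₂ , _ = ∃-between-∉ lo₂<hi₂ (Obstructions proj₂ L)
  in _ , here refl , (lo₁<x , x<hi₁) , (lo₂<y , y<hi₂)
... | no ¬I₁ | _      = ⊥-elim (¬I₁ I₁)
... | yes _  | no ¬I₂ = ⊥-elim (¬I₂ I₂)

data Task : Set where
  cover-dom cover-ran : ℚ → Task
  hit-box             : ℚ → ℚ → ℚ → ℚ → Task

perform : Task → (S : Stage) → Extension (proj₁ S)
perform (cover-dom x)             = coverDom x
perform (cover-ran y)             = coverRan y
perform (hit-box lo₁ hi₁ lo₂ hi₂) = hitBox lo₁ hi₁ lo₂ hi₂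

decodeBox : ℕ → Task
decodeBox k =
  let i , k₁ = unpair k
      j , k₂ = unpair k₁
      l , m  = unpair k₂
  in hit-box (decode i) (decode j) (decode l) (decode m)

task : ℕ → Task
task n with unpair n
... | zero        , k = cover-dom (decode k)
... | suc zero    , k = cover-ran (decode k)
... | suc (suc _) , k = decodeBox k

task-cover-dom : ∀ {x} → 0ℚ ≤ x → task (pair 0 (encode x)) ≡ cover-dom x
task-cover-dom {x} 0≤x rewrite unpair-pair 0 (encode x) | decode-encode 0≤x = refl

task-cover-ran : ∀ {y} → 0ℚ ≤ y → task (pair 1 (encode y)) ≡ cover-ran y
task-cover-ran {y} 0≤y rewrite unpair-pair 1 (encode y) | decode-encode 0≤y = refl

boxCode : ℚ → ℚ → ℚ → ℚ → ℕ
boxCode lo₁ hi₁ lo₂ hi₂ = pair 2 (pair (encode lo₁) (pair (encode hi₁) (pair (encode lo₂) (encode hi₂))))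

task-hit-box : ∀ {lo₁ hi₁ lo₂ hi₂} → UnitSubinterval lo₁ hi₁ → UnitSubinterval lo₂ hi₂ →
  task (boxCode lo₁ hi₁ lo₂ hi₂) ≡ hit-box lo₁ hi₁ lo₂ hi₂
task-hit-box {lo₁} {hi₁} {lo₂} {hi₂} (0≤lo₁ , lo₁<hi₁ , _) (0≤lo₂ , lo₂<hi₂ , _)
  rewrite unpair-pair 2 (pair (encode lo₁) (pair (encode hi₁) (pair (encode lo₂) (encode hi₂))))
        | unpair-pair (encode lo₁) (pair (encode hi₁) (pair (encode lo₂) (encode hi₂)))
        | unpair-pair (encode hi₁) (pair (encode lo₂) (encode hi₂))
        | unpair-pair (encode lo₂) (encode hi₂)
        | decode-encode 0≤lo₁ | decode-encode (≤-trans 0≤lo₁ (<⇒≤ lo₁<hi₁))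
        | decode-encode 0≤lo₂ | decode-encode (≤-trans 0≤lo₂ (<⇒≤ lo₂<hi₂))
  = refl

stage : ℕ → Stage
stage zero    = [] , []-costas
stage (suc n) = extend (stage n) (perform (task n) (stage n))

stageGraph : ℕ → Graph
stageGraph n = proj₁ (stage n)

stageGraph-suc : ∀ n {t} → task n ≡ t → stageGraph (suc n) ≡ proj₁ (extend (stage n) (perform t (stage n)))
stageGraph-suc n refl = refl

stageGraph-mono : ∀ {m n} → m ℕ.≤ n → stageGraph m ⊆ stageGraph n
stageGraph-mono = mono′ ∘ ℕ.≤⇒≤′
  where
  mono′ : ∀ {m n} → m ≤′ n → stageGraph m ⊆ stageGraph n
  mono′ ≤′-refl             = λ p∈ → p∈
  mono′ (≤′-step {n} m≤′n) = extend-⊇ (stage n) (perform (task n) (stage n)) ∘ mono′ m≤′n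

Γ : Point → Set
Γ p = Σ ℕ λ n → p ∈ stageGraph n

Γ-costas : CostasGraph Γ
Γ-costas = ⋃-costas stageGraph stageGraph-mono (proj₂ ∘ stage)

domainStage : ℚ → ℕ
domainStage x = suc (pair 0 (encode x))

domainStage-covers : ∀ {x} → InQ x → x ∈ map proj₁ (stageGraph (domainStage x))
domainStage-covers {x} qx = subst (λ L → x ∈ map proj₁ L)
  (sym (stageGraph-suc (pair 0 (encode x)) (task-cover-dom (proj₁ qx)))) (coverDom-covers (stage (pair 0 (encode x))) qx)

rangeStage : ℚ → ℕ
rangeStage y = suc (pair 1 (encode y))

rangeStage-covers : ∀ {y} → InQ y → y ∈ map proj₂ (stageGraph (rangeStage y))
rangeStage-covers {y} qy = subst (λ L → y ∈ map proj₂ L)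
  (sym (stageGraph-suc (pair 1 (encode y)) (task-cover-ran (proj₁ qy)))) (coverRan-covers (stage (pair 1 (encode y))) qy)

Γ-covers-ran : ∀ {y} → InQ y → Σ ℚ λ x → Γ (x , y)
Γ-covers-ran {y} qy with ∈-map⁻ proj₂ (rangeStage-covers qy)
... | (x , _) , P∈ , refl = x , rangeStage y , P∈

Γ-meets-boxes : MeetsEveryBox Γ
Γ-meets-boxes {lo₁} {hi₁} {lo₂} {hi₂} I₁ I₂ =
  let P , P∈ , inBox = hitBox-hits (stage n) I₁ I₂
  in P , (suc n , subst (P ∈_) (sym (stageGraph-suc n (task-hit-box I₁ I₂))) P∈) , inBox
  where n = boxCode lo₁ hi₁ lo₂ hi₂

valueAt : ℚ → Graph → ℚ
valueAt x [] = 0ℚ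
valueAt x ((a , b) ∷ L) with x ≟ a
... | yes _ = b
... | no _  = valueAt x L

valueAt-∈ : ∀ {x y L} → (∀ {y′} → (x , y′) ∈ L → y′ ≡ y) → (x , y) ∈ L → valueAt x L ≡ y
valueAt-∈ {x} {L = (a , b) ∷ L} unique m with x ≟ a
valueAt-∈ unique m           | yes refl = unique (here refl)
valueAt-∈ unique (here refl) | no x≢a   = ⊥-elim (x≢a refl)
valueAt-∈ unique (there m)   | no _     = valueAt-∈ (unique ∘ there) m

-- Outside Q the junk value 0ℚ of valueAt may occur; it is irrelevant to the theorem.
cloud : ℚ → ℚ
cloud x = valueAt x (stageGraph (domainStage x))

cloud-graph : ∀ {x} → InQ x → Γ (x , cloud x)
cloud-graph {x} qx with ∈-map⁻ proj₁ (domainStage-covers qx)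
... | (_ , y) , P∈ , refl = domainStage x , subst (λ v → (x , v) ∈ stageGraph (domainStage x))
  (sym (valueAt-∈ (λ P′∈ → functional P′∈ P∈) P∈)) P∈
  where open CostasGraph (proj₂ (stage (domainStage x)))
theorem16 : Σ (ℚ → ℚ) BijectiveRationalCostasCloud
theorem16 =
  cloud ,
  costasGraph⇒MapsQ ,
  costasGraph⇒InjectiveOnQ ,
  costasGraph⇒SurjectiveOntoQ Γ-covers-ran ,
  graphDenseQ⇒nowhereContinuousQ {cloud} dense ,
  dense ,
  costasGraph⇒CostasQ
  where
  open GraphInCostasGraph Γ-costas {cloud} cloud-graph

  dense : GraphDenseQ cloud
  dense = costasGraph⇒GraphDenseQ Γ-meets-boxes
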